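{- For every positive integer $n$, $\chi'_{\{2K_2, C_4\}}(n)= \lceil n/2 \rceil$.
   Context: For a graph $G$ and a set $\mathcal H$ of small graphs, an $\mathcal H$-avoiding bipartite partition of $G$ is a collection of bipartite graphs $G_1,\dots,G_k$ (subgraphs of $G$, each without isolated vertices and nonempty) whose edge sets are pairwise disjoint with union $E(G)$, such that no $G_i$ contains any member of $\mathcal H$ as an induced subgraph. $\chi'_{\mathcal H}(G)$ is the smallest $k$ for which such a partition with $k$ graphs exists, and $\chi'_{\mathcal H}(n):=\chi'_{\mathcal H}(K_n)$, where $K_n$ is the complete graph on $n$ vertices. $2K_2$ is the disjoint union of two edges and $C_4$ is the cycle on 4 vertices. -}

module Defs where

open import Data.Nat using (ℕ)
open import Data.Fin using (Fin)
open import Data.Bool using (Bool)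
open import Data.Product using (Σ; _×_; ∃)
open import Relation.Binary.PropositionalEquality using (_≡_; _≢_)
open import Relation.Nullary using (¬_)

-- A partition of the edge set of K_n (vertex set Fin n) into k parts is
-- encoded by a labelling assigning to every edge {u,v} (u ≢ v) exactly one
-- label in Fin k.  The labelling is a function on ordered pairs required to
-- be symmetric; its values on the diagonal are irrelevant.
-- This makes the parts pairwise edge-disjoint and covering E(K_n).
record EdgeLabelling (n k : ℕ) : Set where
  field
    lab  : Fin n → Fin n → Fin k
    symm : ∀ u v → lab u v ≡ lab v u

module _ {n k : ℕ} (L : EdgeLabelling n k) where
  open EdgeLabelling L

  InPart : Fin k → Fin n → Fin n → Set
  InPart i u v = (u ≢ v) × (lab u v ≡ i)

  -- G_i is nonempty (has at least one edge); its vertex set is the set of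
  -- endpoints of its edges, so it has no isolated vertices by construction.
  NonemptyPart : Fin k → Set
  NonemptyPart i = Σ (Fin n) λ u → Σ (Fin n) λ v → InPart i u v

  BipartitePart : Fin k → Set
  BipartitePart i = Σ (Fin n → Bool) λ col →
    ∀ u v → InPart i u v → col u ≢ col v

  Distinct4 : Fin n → Fin n → Fin n → Fin n → Set
  Distinct4 a b c d =
    (a ≢ b) × (a ≢ c) × (a ≢ d) × (b ≢ c) × (b ≢ d) × (c ≢ d)

  -- G_i contains 2K_2 as an induced subgraph: distinct a,b,c,d with
  -- ab, cd edges of G_i and ac, ad, bc, bd non-edges of G_i.
  -- (All four vertices are incident to edges of G_i, so they lie in V(G_i).)
  Induced2K2 : Fin k → Set
  Induced2K2 i = Σ (Fin n) λ a → Σ (Fin n) λ b → Σ (Fin n) λ c → Σ (Fin n) λ d →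
    Distinct4 a b c d × InPart i a b × InPart i c d ×
    ¬ InPart i a c × ¬ InPart i a d × ¬ InPart i b c × ¬ InPart i b d

  InducedC4 : Fin k → Set
  InducedC4 i = Σ (Fin n) λ a → Σ (Fin n) λ b → Σ (Fin n) λ c → Σ (Fin n) λ d →
    Distinct4 a b c d × InPart i a b × InPart i b c × InPart i c d × InPart i d a ×
    ¬ InPart i a c × ¬ InPart i b d

record AvoidingBipartitePartition (n k : ℕ) : Set where
  field
    labelling : EdgeLabelling n k
    nonempty  : ∀ i → NonemptyPart labelling i
    bipartite : ∀ i → BipartitePart labelling i
    no2K2     : ∀ i → ¬ Induced2K2 labelling i
    noC4      : ∀ i → ¬ InducedC4 labelling i

IsChiPrime : ℕ → ℕ → Set
IsChiPrime n m =
  AvoidingBipartitePartition n m × (∀ k → AvoidingBipartitePartition n k → m Data.Nat.≤ k)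

{-# OPTIONS --safe #-}
-- Lower bound: call a vertex heavy in a part if it has two neighbours there.
-- Two distinct heavy vertices of the same colour in a bipartite part have
-- either two common neighbours (an induced C₄) or a private neighbour each
-- (an induced 2K₂), so every part has at most two heavy vertices.  Hence either
-- n ≤ 2k, or some vertex is heavy in no part; then its n − 1 edges lie in
-- pairwise distinct parts and n − 1 ≤ k.
--
-- Upper bound: pair vertex 2t with 2t + 1 and label the edge xy by the minimum
-- or the maximum of ⌊x/2⌋ and ⌊y/2⌋ according as x + y is even or odd.  Part t
-- is then a double star with the adjacent centres 2t and 2t + 1 (for odd n and
-- the last t, a star at 2t = n − 1), and double stars are bipartite, 2K₂-free
-- and C₄-free.
module Submission where

open import Defs
open import Data.Nat using (ℕ; _≤_; ⌈_/2⌉)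
open import Data.Nat using (suc; _+_; _<_; _<?_; _⊓_; _⊔_; ⌊_/2⌋; parity; s≤s; z≤n)
open import Data.Nat.Properties
  using ( +-comm; +-suc; ⊓-comm; ⊔-comm; ⊓-sel; ⊔-sel; ⊓-idem; ⊔-idem
        ; m⊓n≡n⇒n≤m; m⊔n≡n⇒m≤n; ≤-antisym; ≤-trans; ≤-reflexive; ≰⇒>; ≮⇒≥; <⇒≱
        ; 1+n≢n; ⌈n/2⌉-mono; ⌈n/2⌉≤n; n≡⌊n+n/2⌋; n≡⌈n+n/2⌉ )
open import Data.Parity.Base using (Parity; 0ℙ; 1ℙ; _⁻¹)
open import Data.Parity.Properties using (⁻¹-involutive; suc-homo-⁻¹; +-homo-+; p+p≡0ℙ)
open import Data.Bool using (Bool; true; false; not)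
open import Data.Bool.Properties using (¬-not)
open import Data.Empty using (⊥-elim)
open import Data.Fin using (Fin; toℕ; fromℕ<; join; splitAt; punchIn)
open import Data.Fin.Properties
  using ( _≟_; any?; all?; ¬∀⟶∃¬; injective⇒≤; splitAt-join; toℕ<n; toℕ-fromℕ<
        ; toℕ-injective; fromℕ<-cong; fromℕ<-injective; punchIn-injective; punchInᵢ≢i )
open import Data.Product using (∃; ∃₂; _×_; _,_; proj₁; proj₂; swap)
open import Data.Sum using (_⊎_; inj₁; inj₂; [_,_]′)
import Data.Sum as Sum
open import Function using (_∘_)
open import Function.Definitions using (Injective)
open import Relation.Binary.PropositionalEquality
  using (_≡_; _≢_; refl; sym; trans; cong; cong₂; subst; module ≡-Reasoning)
open import Relation.Nullary using (¬_; Dec; yes; no; does)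
open import Relation.Nullary.Decidable using (¬?; _×-dec_; decidable-stable)

open ≡-Reasoning

exactlyOne⇒does≢ : ∀ {p q} {P : Set p} {Q : Set q} (P? : Dec P) (Q? : Dec Q) →
                   P ⊎ Q → ¬ (P × Q) → does P? ≢ does Q?
exactlyOne⇒does≢ (yes p) (yes q) _   notBoth = λ _ → notBoth (p , q)
exactlyOne⇒does≢ (yes _) (no _)  _   _       = λ ()
exactlyOne⇒does≢ (no _)  (yes _) _   _       = λ ()
exactlyOne⇒does≢ (no ¬p) (no ¬q) p⊎q _       = λ _ → [ ¬p , ¬q ]′ p⊎q

tag : ∀ {a} {A : Set a} → Bool → A → A ⊎ A
tag true  = inj₁
tag false = inj₂

tag-injective : ∀ {a} {A : Set a} {b c : Bool} {x y : A} → tag b x ≡ tag c y → b ≡ c × x ≡ y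
tag-injective {b = true}  {true}  refl = refl , refl
tag-injective {b = false} {false} refl = refl , refl
tag-injective {b = true}  {false} ()
tag-injective {b = false} {true}  ()

join-injective : ∀ m n → Injective _≡_ _≡_ (join m n)
join-injective m n {x} {y} eq = begin
  x                      ≡⟨ splitAt-join m n x ⟨
  splitAt m (join m n x) ≡⟨ cong (splitAt m) eq ⟩
  splitAt m (join m n y) ≡⟨ splitAt-join m n y ⟩
  y                      ∎

toℕ≡⇒≡fromℕ< : ∀ {n m} {w : Fin n} (m<n : m < n) → toℕ w ≡ m → w ≡ fromℕ< m<n
toℕ≡⇒≡fromℕ< m<n e = toℕ-injective (trans e (sym (toℕ-fromℕ< m<n)))

module Part {n k : ℕ} (L : EdgeLabelling n k) (i : Fin k) where
  open EdgeLabelling L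

  infix 4 _∼_
  _∼_ : Fin n → Fin n → Set
  u ∼ v = InPart L i u v

  ∼-sym : ∀ {u v} → u ∼ v → v ∼ u
  ∼-sym {u} {v} (u≢v , uv≡i) = u≢v ∘ sym , trans (symm v u) uv≡i

  ∼-irrefl : ∀ {u} → ¬ u ∼ u
  ∼-irrefl (u≢u , _) = u≢u refl

  _∼?_ : ∀ u v → Dec (u ∼ v)
  u ∼? v = ¬? (u ≟ v) ×-dec (lab u v ≟ i)

  Heavy : Fin n → Set
  Heavy v = ∃₂ λ a b → a ≢ b × v ∼ a × v ∼ b

  heavy? : ∀ v → Dec (Heavy v)
  heavy? v = any? λ a → any? λ b → ¬? (a ≟ b) ×-dec v ∼? a ×-dec v ∼? b

  module ProperColouring (col : Fin n → Bool) (proper : ∀ u v → u ∼ v → col u ≢ col v) where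

    sameColour⇒≁ : ∀ {u v} → col u ≡ col v → ¬ u ∼ v
    sameColour⇒≁ {u} {v} uv u∼v = proper u v u∼v uv

    neighbours-sameColour : ∀ {u v a b} → u ∼ a → v ∼ b → col u ≡ col v → col a ≡ col b
    neighbours-sameColour {u} {v} {a} {b} u∼a v∼b uv = begin
      col a       ≡⟨ ¬-not (proper a u (∼-sym u∼a)) ⟩
      not (col u) ≡⟨ cong not uv ⟩
      not (col v) ≡⟨ ¬-not (proper b v (∼-sym v∼b)) ⟨
      col b       ∎

    commonNeighbours⇒C4 : ∀ {u v a b} → u ≢ v → col u ≡ col v → a ≢ b →
                          u ∼ a → u ∼ b → v ∼ a → v ∼ b → InducedC4 L i
    commonNeighbours⇒C4 {u} {v} {a} {b} u≢v uv a≢b u∼a u∼b v∼a v∼b =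
      u , a , v , b ,
      (proj₁ u∼a , u≢v , proj₁ u∼b , proj₁ (∼-sym v∼a) , a≢b , proj₁ v∼b) ,
      u∼a , ∼-sym v∼a , v∼b , ∼-sym u∼b ,
      sameColour⇒≁ uv , sameColour⇒≁ (neighbours-sameColour u∼a u∼b refl)

    privateNeighbours⇒2K2 : ∀ {u v a c} → u ≢ v → col u ≡ col v →
                            u ∼ a → v ∼ c → ¬ v ∼ a → ¬ u ∼ c → Induced2K2 L i
    privateNeighbours⇒2K2 {u} {v} {a} {c} u≢v uv u∼a v∼c v≁a u≁c =
      u , a , v , c ,
      (proj₁ u∼a , u≢v , u≢c , a≢v , a≢c , proj₁ v∼c) ,
      u∼a , v∼c ,
      sameColour⇒≁ uv , u≁c , v≁a ∘ ∼-sym ,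
      sameColour⇒≁ (neighbours-sameColour u∼a v∼c uv)
      where
      u≢c : u ≢ c
      u≢c refl = sameColour⇒≁ (sym uv) v∼c
      a≢v : a ≢ v
      a≢v refl = sameColour⇒≁ uv u∼a
      a≢c : a ≢ c
      a≢c refl = v≁a v∼c

    heavy⇒privateNeighbour : ∀ {u v} → ¬ InducedC4 L i → u ≢ v → col u ≡ col v →
                             Heavy u → ∃ λ a → u ∼ a × ¬ v ∼ a
    heavy⇒privateNeighbour {u} {v} noC4 u≢v uv (a , b , a≢b , u∼a , u∼b) with v ∼? a | v ∼? b
    ... | no v≁a  | _       = a , u∼a , v≁a
    ... | yes _   | no v≁b  = b , u∼b , v≁b
    ... | yes v∼a | yes v∼b = ⊥-elim (noC4 (commonNeighbours⇒C4 u≢v uv a≢b u∼a u∼b v∼a v∼b))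

    heavy-sameColour⇒≡ : ¬ Induced2K2 L i → ¬ InducedC4 L i →
                          ∀ {u v} → col u ≡ col v → Heavy u → Heavy v → u ≡ v
    heavy-sameColour⇒≡ no2K2 noC4 {u} {v} uv hu hv = decidable-stable (u ≟ v) λ u≢v →
      let (a , u∼a , v≁a) = heavy⇒privateNeighbour noC4 u≢v uv hu
          (c , v∼c , u≁c) = heavy⇒privateNeighbour noC4 (u≢v ∘ sym) (sym uv) hv
      in no2K2 (privateNeighbours⇒2K2 u≢v uv u∼a v∼c v≁a u≁c)

  record IsDoubleStar (c₀ c₁ : Fin n) : Set where
    field
      centres-adjacent : c₀ ∼ c₁
      covers           : ∀ {u v} → u ∼ v → (u ≡ c₀ ⊎ u ≡ c₁) ⊎ (v ≡ c₀ ⊎ v ≡ c₁)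
      noCommonLeaf     : ∀ {x} → x ∼ c₀ → ¬ x ∼ c₁

  star⇒isDoubleStar : ∀ {c₀ c₁} → c₀ ∼ c₁ → (∀ {u v} → u ∼ v → u ≡ c₀ ⊎ v ≡ c₀) →
                      IsDoubleStar c₀ c₁
  star⇒isDoubleStar c₀∼c₁ star = record
    { centres-adjacent = c₀∼c₁
    ; covers           = Sum.map inj₁ inj₁ ∘ star
    ; noCommonLeaf     = λ x∼c₀ x∼c₁ → [ proj₁ x∼c₀ , proj₁ c₀∼c₁ ∘ sym ]′ (star x∼c₁)
    }

  module _ {c₀ c₁ : Fin n} (doubleStar : IsDoubleStar c₀ c₁) where
    open IsDoubleStar doubleStar

    IsCentre : Fin n → Set
    IsCentre x = x ≡ c₀ ⊎ x ≡ c₁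

    nonEdge⇒notBothCentres : ∀ {x y} → x ≢ y → ¬ x ∼ y → IsCentre x → ¬ IsCentre y
    nonEdge⇒notBothCentres x≢y _   (inj₁ refl) (inj₁ refl) = x≢y refl
    nonEdge⇒notBothCentres _   x≁y (inj₁ refl) (inj₂ refl) = x≁y centres-adjacent
    nonEdge⇒notBothCentres _   x≁y (inj₂ refl) (inj₁ refl) = x≁y (∼-sym centres-adjacent)
    nonEdge⇒notBothCentres x≢y _   (inj₂ refl) (inj₂ refl) = x≢y refl

    doubleStar-nonempty : NonemptyPart L i
    doubleStar-nonempty = c₀ , c₁ , centres-adjacent

    doubleStar-bipartite : BipartitePart L i
    doubleStar-bipartite = (λ x → does (x ∼? c₀)) , proper
      where
      centreEnd : ∀ {u v} → IsCentre u → u ∼ v → (u ∼ c₀ ⊎ v ∼ c₀) × ¬ (u ∼ c₀ × v ∼ c₀)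
      centreEnd (inj₁ refl) u∼v = inj₂ (∼-sym u∼v) , ∼-irrefl ∘ proj₁
      centreEnd (inj₂ refl) u∼v =
        inj₁ (∼-sym centres-adjacent) , λ (_ , v∼c₀) → noCommonLeaf v∼c₀ (∼-sym u∼v)

      proper : ∀ u v → u ∼ v → does (u ∼? c₀) ≢ does (v ∼? c₀)
      proper u v u∼v with covers u∼v
      ... | inj₁ cu = let (one , notBoth) = centreEnd cu u∼v in
        exactlyOne⇒does≢ (u ∼? c₀) (v ∼? c₀) one notBoth
      ... | inj₂ cv = let (one , notBoth) = centreEnd cv (∼-sym u∼v) in
        exactlyOne⇒does≢ (u ∼? c₀) (v ∼? c₀) (Sum.swap one) (notBoth ∘ swap)

    doubleStar-no2K2 : ¬ Induced2K2 L i
    doubleStar-no2K2 (a , b , c , d , (_ , a≢c , a≢d , b≢c , b≢d , _) , a∼b , c∼d , a≁c , a≁d , b≁c , b≁d)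
      with covers a∼b | covers c∼d
    ... | inj₁ ca | inj₁ cc = nonEdge⇒notBothCentres a≢c a≁c ca cc
    ... | inj₁ ca | inj₂ cd = nonEdge⇒notBothCentres a≢d a≁d ca cd
    ... | inj₂ cb | inj₁ cc = nonEdge⇒notBothCentres b≢c b≁c cb cc
    ... | inj₂ cb | inj₂ cd = nonEdge⇒notBothCentres b≢d b≁d cb cd

    doubleStar-noC4 : ¬ InducedC4 L i
    doubleStar-noC4 (a , b , c , d , (_ , a≢c , _ , _ , b≢d , _) , a∼b , b∼c , c∼d , d∼a , a≁c , b≁d)
      with covers a∼b | covers c∼d
    ... | inj₁ ca | inj₁ cc = nonEdge⇒notBothCentres a≢c a≁c ca cc
    ... | inj₂ cb | inj₂ cd = nonEdge⇒notBothCentres b≢d b≁d cb cd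
    ... | inj₁ ca | inj₂ cd =
      [ (λ cb → nonEdge⇒notBothCentres b≢d b≁d cb cd) , nonEdge⇒notBothCentres a≢c a≁c ca ]′ (covers b∼c)
    ... | inj₂ cb | inj₁ cc =
      [ nonEdge⇒notBothCentres b≢d b≁d cb , (λ ca → nonEdge⇒notBothCentres a≢c a≁c ca cc) ]′ (covers d∼a)

doubleStars⇒partition : ∀ {n k} (L : EdgeLabelling n k) →
                        (∀ i → ∃₂ (Part.IsDoubleStar L i)) → AvoidingBipartitePartition n k
doubleStars⇒partition L doubleStars = record
  { labelling = L
  ; nonempty  = λ i → Part.doubleStar-nonempty L i (star i)
  ; bipartite = λ i → Part.doubleStar-bipartite L i (star i)
  ; no2K2     = λ i → Part.doubleStar-no2K2 L i (star i)
  ; noC4      = λ i → Part.doubleStar-noC4 L i (star i)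
  }
  where
  star : ∀ i → Part.IsDoubleStar L i _ _
  star i = proj₂ (proj₂ (doubleStars i))

notHeavyAnywhere⇒m≤k : ∀ {m k} (L : EdgeLabelling (suc m) k) v →
                       ¬ ∃ (λ i → Part.Heavy L i v) → m ≤ k
notHeavyAnywhere⇒m≤k {m} {k} L v notHeavy = injective⇒≤ {f = labelTowards} injective
  where
  open EdgeLabelling L
  labelTowards : Fin m → Fin k
  labelTowards j = lab v (punchIn v j)
  injective : Injective _≡_ _≡_ labelTowards
  injective {a} {b} sameLabel =
    punchIn-injective v a b (decidable-stable (punchIn v a ≟ punchIn v b) λ a≢b →
      notHeavy (lab v (punchIn v a) , punchIn v a , punchIn v b , a≢b ,
                (punchInᵢ≢i v a ∘ sym , refl) , (punchInᵢ≢i v b ∘ sym , sym sameLabel)))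

module _ {n k : ℕ} (P : AvoidingBipartitePartition n k) where
  open AvoidingBipartitePartition P
  open Part labelling using (Heavy; heavy?)

  heavySomewhere? : ∀ v → Dec (∃ λ i → Heavy i v)
  heavySomewhere? v = any? λ i → heavy? i v

  colour : Fin k → Fin n → Bool
  colour i = proj₁ (bipartite i)

  -- a heavy vertex is determined by a part where it is heavy and its colour there
  allHeavy⇒n≤k+k : (∀ v → ∃ λ i → Heavy i v) → n ≤ k + k
  allHeavy⇒n≤k+k heavy = injective⇒≤ {f = slot} injective
    where
    slot : Fin n → Fin (k + k)
    slot v = let i = proj₁ (heavy v) in join k k (tag (colour i v) i)

    sameTag⇒≡ : ∀ {i j x y} → Heavy i x → Heavy j y → tag (colour i x) i ≡ tag (colour j y) j → x ≡ y
    sameTag⇒≡ {i} hx hy eq with tag-injective eq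
    ... | sameColour , refl =
      Part.ProperColouring.heavy-sameColour⇒≡ labelling i (colour i) (proj₂ (bipartite i))
        (no2K2 i) (noC4 i) sameColour hx hy

    injective : Injective _≡_ _≡_ slot
    injective {x} {y} = sameTag⇒≡ (proj₂ (heavy x)) (proj₂ (heavy y)) ∘ join-injective k k

lowerBound : ∀ {n k} → 2 ≤ n → AvoidingBipartitePartition n k → ⌈ n /2⌉ ≤ k
lowerBound {suc (suc m)} {k} (s≤s (s≤s z≤n)) P with all? (heavySomewhere? P)
... | yes heavy = ≤-trans (⌈n/2⌉-mono (allHeavy⇒n≤k+k P heavy)) (≤-reflexive (sym (n≡⌈n+n/2⌉ k)))
... | no notAllHeavy with ¬∀⟶∃¬ _ _ (heavySomewhere? P) notAllHeavy
...   | v , notHeavy =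
  ≤-trans (s≤s (⌈n/2⌉≤n m)) (notHeavyAnywhere⇒m≤k (AvoidingBipartitePartition.labelling P) v notHeavy)

meetOrJoin : Parity → ℕ → ℕ → ℕ
meetOrJoin 0ℙ = _⊓_
meetOrJoin 1ℙ = _⊔_

meetOrJoin-comm : ∀ p x y → meetOrJoin p x y ≡ meetOrJoin p y x
meetOrJoin-comm 0ℙ = ⊓-comm
meetOrJoin-comm 1ℙ = ⊔-comm

meetOrJoin-sel : ∀ p x y → meetOrJoin p x y ≡ x ⊎ meetOrJoin p x y ≡ y
meetOrJoin-sel 0ℙ = ⊓-sel
meetOrJoin-sel 1ℙ = ⊔-sel

meetOrJoin-idem : ∀ p x → meetOrJoin p x x ≡ x
meetOrJoin-idem 0ℙ = ⊓-idem
meetOrJoin-idem 1ℙ = ⊔-idem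

meetOrJoin-⁻¹ : ∀ p {x y} → meetOrJoin p x y ≡ y → meetOrJoin (p ⁻¹) x y ≡ y → x ≡ y
meetOrJoin-⁻¹ 0ℙ x⊓y≡y x⊔y≡y = ≤-antisym (m⊔n≡n⇒m≤n x⊔y≡y) (m⊓n≡n⇒n≤m x⊓y≡y)
meetOrJoin-⁻¹ 1ℙ x⊔y≡y x⊓y≡y = ≤-antisym (m⊔n≡n⇒m≤n x⊔y≡y) (m⊓n≡n⇒n≤m x⊓y≡y)

parity-suc : ∀ n → parity (suc n) ≡ parity n ⁻¹
parity-suc n = trans (sym (⁻¹-involutive (parity (suc n)))) (cong _⁻¹ (suc-homo-⁻¹ n))

parity-double : ∀ t → parity (t + t) ≡ 0ℙ
parity-double t = trans (+-homo-+ t t) (p+p≡0ℙ (parity t))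

double≢1 : ∀ t → t + t ≢ 1
double≢1 t e with trans (sym (parity-double t)) (cong parity e)
... | ()

⌊n/2⌋≡t⇒twin : ∀ x {t} → ⌊ x /2⌋ ≡ t → x ≡ t + t ⊎ x ≡ suc (t + t)
⌊n/2⌋≡t⇒twin 0             refl = inj₁ refl
⌊n/2⌋≡t⇒twin 1             refl = inj₂ refl
⌊n/2⌋≡t⇒twin (suc (suc x)) refl = Sum.map
  (λ e → trans (cong (suc ∘ suc) e) twinStep)
  (λ e → trans (cong (suc ∘ suc) e) (cong suc twinStep))
  (⌊n/2⌋≡t⇒twin x refl)
  where
  h = ⌊ x /2⌋
  twinStep : suc (suc (h + h)) ≡ suc h + suc h
  twinStep = cong suc (sym (+-suc h h))

t<⌈n/2⌉⇒t+t<n : ∀ {t n} → t < ⌈ n /2⌉ → t + t < n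
t<⌈n/2⌉⇒t+t<n {t} {n} t<⌈n/2⌉ = ≰⇒> λ n≤t+t →
  <⇒≱ t<⌈n/2⌉ (subst (⌈ n /2⌉ ≤_) (sym (n≡⌈n+n/2⌉ t)) (⌈n/2⌉-mono n≤t+t))

pairLabel : ℕ → ℕ → ℕ
pairLabel x y = meetOrJoin (parity (x + y)) ⌊ x /2⌋ ⌊ y /2⌋

pairLabel-comm : ∀ x y → pairLabel x y ≡ pairLabel y x
pairLabel-comm x y = begin
  meetOrJoin (parity (x + y)) ⌊ x /2⌋ ⌊ y /2⌋
    ≡⟨ cong (λ p → meetOrJoin p ⌊ x /2⌋ ⌊ y /2⌋) (cong parity (+-comm x y)) ⟩
  meetOrJoin (parity (y + x)) ⌊ x /2⌋ ⌊ y /2⌋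
    ≡⟨ meetOrJoin-comm (parity (y + x)) ⌊ x /2⌋ ⌊ y /2⌋ ⟩
  pairLabel y x ∎

pairLabel-sel : ∀ x y → pairLabel x y ≡ ⌊ x /2⌋ ⊎ pairLabel x y ≡ ⌊ y /2⌋
pairLabel-sel x y = meetOrJoin-sel (parity (x + y)) ⌊ x /2⌋ ⌊ y /2⌋

pairLabel<⌈n/2⌉ : ∀ {n x y} → x < n → y < n → pairLabel x y < ⌈ n /2⌉
pairLabel<⌈n/2⌉ {n} {x} {y} x<n y<n =
  [ (λ e → subst (_< ⌈ n /2⌉) (sym e) (⌈n/2⌉-mono x<n))
  , (λ e → subst (_< ⌈ n /2⌉) (sym e) (⌈n/2⌉-mono y<n)) ]′ (pairLabel-sel x y)

pairLabel-twins : ∀ t → pairLabel (t + t) (suc (t + t)) ≡ t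
pairLabel-twins t = begin
  meetOrJoin p ⌊ t + t /2⌋ ⌈ t + t /2⌉ ≡⟨ cong₂ (meetOrJoin p) (n≡⌊n+n/2⌋ t) (n≡⌈n+n/2⌉ t) ⟨
  meetOrJoin p t t                     ≡⟨ meetOrJoin-idem p t ⟩
  t                                    ∎
  where p = parity (t + t + suc (t + t))

pairLabel-1-double : ∀ t → pairLabel 1 (t + t) ≡ t
pairLabel-1-double t = begin
  meetOrJoin (parity (suc (t + t))) 0 ⌊ t + t /2⌋
    ≡⟨ cong (λ p → meetOrJoin p 0 ⌊ t + t /2⌋) (trans (parity-suc (t + t)) (cong _⁻¹ (parity-double t))) ⟩
  ⌊ t + t /2⌋
    ≡⟨ n≡⌊n+n/2⌋ t ⟨
  t ∎

-- Of the edges from x to the twins 2t and 2t + 1, one gets ⌊x/2⌋ ⊓ t and the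
-- other ⌊x/2⌋ ⊔ t, since x + 2t and x + 2t + 1 have opposite parities.
pairLabel≡t-twice⇒⌊x/2⌋≡t : ∀ x t → pairLabel x (t + t) ≡ t → pairLabel x (suc (t + t)) ≡ t →
                            ⌊ x /2⌋ ≡ t
pairLabel≡t-twice⇒⌊x/2⌋≡t x t x∼2t x∼2t+1 =
  meetOrJoin-⁻¹ p (trans (sym toEven) x∼2t) (trans (sym toOdd) x∼2t+1)
  where
  p = parity (x + (t + t))
  toEven : pairLabel x (t + t) ≡ meetOrJoin p ⌊ x /2⌋ t
  toEven = cong (meetOrJoin p ⌊ x /2⌋) (sym (n≡⌊n+n/2⌋ t))
  toOdd : pairLabel x (suc (t + t)) ≡ meetOrJoin (p ⁻¹) ⌊ x /2⌋ t
  toOdd = cong₂ (λ q h → meetOrJoin q ⌊ x /2⌋ h)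
                (trans (cong parity (+-suc x (t + t))) (parity-suc (x + (t + t))))
                (sym (n≡⌈n+n/2⌉ t))

module Construction {n : ℕ} (2≤n : 2 ≤ n) where

  labelling : EdgeLabelling n ⌈ n /2⌉
  labelling = record
    { lab  = λ u v → fromℕ< (pairLabel<⌈n/2⌉ (toℕ<n u) (toℕ<n v))
    ; symm = λ u v → fromℕ<-cong _ _ (pairLabel-comm (toℕ u) (toℕ v)) _ _
    }

  module _ (i : Fin ⌈ n /2⌉) where
    open Part labelling i

    t : ℕ
    t = toℕ i

    ∼⇒pairLabel : ∀ {u v} → u ∼ v → pairLabel (toℕ u) (toℕ v) ≡ t
    ∼⇒pairLabel (_ , uv≡i) = trans (sym (toℕ-fromℕ< _)) (cong toℕ uv≡i)

    ∼fromℕ<⇒pairLabel : ∀ {x m} (m<n : m < n) → x ∼ fromℕ< m<n → pairLabel (toℕ x) m ≡ t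
    ∼fromℕ<⇒pairLabel {x} m<n x∼ = subst (λ m → pairLabel (toℕ x) m ≡ t) (toℕ-fromℕ< m<n) (∼⇒pairLabel x∼)

    fromℕ<∼fromℕ< : ∀ {a b} (a<n : a < n) (b<n : b < n) → a ≢ b → pairLabel a b ≡ t →
                    fromℕ< a<n ∼ fromℕ< b<n
    fromℕ<∼fromℕ< {a} {b} a<n b<n a≢b ab≡t =
      a≢b ∘ fromℕ<-injective _ _ a<n b<n ,
      toℕ-injective (begin
        toℕ (fromℕ< _)                                   ≡⟨ toℕ-fromℕ< _ ⟩
        pairLabel (toℕ (fromℕ< a<n)) (toℕ (fromℕ< b<n)) ≡⟨ cong₂ pairLabel (toℕ-fromℕ< a<n) (toℕ-fromℕ< b<n) ⟩
        pairLabel a b                                    ≡⟨ ab≡t ⟩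
        t                                                ∎)

    ∼⇒endpointInPair : ∀ {u v} → u ∼ v → ⌊ toℕ u /2⌋ ≡ t ⊎ ⌊ toℕ v /2⌋ ≡ t
    ∼⇒endpointInPair {u} {v} u∼v =
      Sum.map (λ e → trans (sym e) uv≡t) (λ e → trans (sym e) uv≡t) (pairLabel-sel (toℕ u) (toℕ v))
      where uv≡t = ∼⇒pairLabel u∼v

    t+t<n : t + t < n
    t+t<n = t<⌈n/2⌉⇒t+t<n (toℕ<n i)

    c₀ : Fin n
    c₀ = fromℕ< t+t<n

    twinsPart : (2t+1<n : suc (t + t) < n) → IsDoubleStar c₀ (fromℕ< 2t+1<n)
    twinsPart 2t+1<n = record
      { centres-adjacent = fromℕ<∼fromℕ< t+t<n 2t+1<n (1+n≢n ∘ sym) (pairLabel-twins t)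
      ; covers           = Sum.map inPair⇒centre inPair⇒centre ∘ ∼⇒endpointInPair
      ; noCommonLeaf     = λ {x} x∼c₀ x∼c₁ → [ proj₁ x∼c₀ , proj₁ x∼c₁ ]′ (inPair⇒centre
          (pairLabel≡t-twice⇒⌊x/2⌋≡t (toℕ x) t
            (∼fromℕ<⇒pairLabel t+t<n x∼c₀) (∼fromℕ<⇒pairLabel 2t+1<n x∼c₁)))
      }
      where
      inPair⇒centre : ∀ {w} → ⌊ toℕ w /2⌋ ≡ t → w ≡ c₀ ⊎ w ≡ fromℕ< 2t+1<n
      inPair⇒centre {w} h =
        Sum.map (toℕ≡⇒≡fromℕ< t+t<n) (toℕ≡⇒≡fromℕ< 2t+1<n) (⌊n/2⌋≡t⇒twin (toℕ w) h)

    -- 2t = n − 1 has no twin: part t is the star at 2t, and 1 is one of its leaves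
    lastPart : n ≤ suc (t + t) → IsDoubleStar c₀ (fromℕ< 2≤n)
    lastPart n≤2t+1 = star⇒isDoubleStar
      (fromℕ<∼fromℕ< t+t<n 2≤n (double≢1 t) (trans (pairLabel-comm (t + t) 1) (pairLabel-1-double t)))
      (Sum.map inPair⇒c₀ inPair⇒c₀ ∘ ∼⇒endpointInPair)
      where
      inPair⇒c₀ : ∀ {w} → ⌊ toℕ w /2⌋ ≡ t → w ≡ c₀
      inPair⇒c₀ {w} h =
        [ toℕ≡⇒≡fromℕ< t+t<n
        , (λ e → ⊥-elim (<⇒≱ (toℕ<n w) (subst (n ≤_) (sym e) n≤2t+1))) ]′ (⌊n/2⌋≡t⇒twin (toℕ w) h)

    part-isDoubleStar : ∃₂ IsDoubleStar
    part-isDoubleStar with suc (t + t) <? n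
    ... | yes 2t+1<n = c₀ , fromℕ< 2t+1<n , twinsPart 2t+1<n
    ... | no 2t+1≮n = c₀ , fromℕ< 2≤n , lastPart (≮⇒≥ 2t+1≮n)

  partition : AvoidingBipartitePartition n ⌈ n /2⌉
  partition = doubleStars⇒partition labelling part-isDoubleStar

mainTheorem3 : ∀ (n : ℕ) → 2 ≤ n → IsChiPrime n ⌈ n /2⌉
mainTheorem3 n 2≤n = Construction.partition 2≤n , λ k → lowerBound 2≤n
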